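{- Let $N,K\ge1$ and $\mathcal D=\{V,U_N,D_K\}$. For $m\ge0$ and $n\ge1$, $$|\mathcal F_{\mathcal D}(m,n)|=\sum_{k=0}^{\lfloor\frac{Nn+m}{N+K}\rfloor}\binom nk\binom{n(N+1)-k(N+K)+m}{n},\qquad |\mathcal P_{\mathcal D}(1,n)|=\frac1n\sum_{k=0}^{\lfloor\frac{Nn+1}{N+K}\rfloor}\binom nk\binom{n(N+1)-k(N+K)}{n-1}.$$
   Context: Steps: $V=(0,-1)$ and $S_k=(1,k)$; $U_k=S_k$ for $k\ge0$, $D_j=S_{ -j}$ for $j\ge1$. For a set of steps $\mathcal S$, an $\mathcal S$-path is a finite sequence of steps from $\mathcal S$ starting at $(0,0)$. $\mathcal F_{\mathcal S}(m,n)$ is the set of $\mathcal S$-paths ending at $(n,-m)$; $\mathcal P_{\mathcal S}(m,n)$ is the subset of those all of whose points except possibly the last lie on or above the $x$-axis. -}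

module Defs where

open import Data.Nat as ℕ using (ℕ; zero; suc; _*_; _∸_; _/_)
open import Data.Integer as ℤ using (ℤ; +_; -_; 0ℤ)
open import Data.Product using (Σ; _×_; _,_)
open import Data.Unit using (⊤)
open import Data.List using (List; []; _∷_; length)
open import Data.List.Relation.Unary.All using (All)
open import Data.List.Relation.Unary.Unique.Propositional using (Unique)
open import Data.List.Membership.Propositional using (_∈_)
open import Function.Bundles using (_⇔_)
open import Relation.Binary.PropositionalEquality using (_≡_)

data Step : Set where
  V : Step
  S : ℤ → Step

U : ℕ → Step
U k = S (+ k)

D : ℕ → Step
D j = S (- (+ j))

dx : Step → ℤ
dx V     = 0ℤ
dx (S _) = + 1

dy : Step → ℤ
dy V     = - (+ 1)
dy (S k) = k

data InD (N K : ℕ) : Step → Set where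
  isV : InD N K V
  isU : InD N K (U N)
  isD : InD N K (D K)

Path : Set
Path = List Step

endFrom : ℤ × ℤ → Path → ℤ × ℤ
endFrom (x , y) []      = (x , y)
endFrom (x , y) (s ∷ p) = endFrom (x ℤ.+ dx s , y ℤ.+ dy s) p

endpoint : Path → ℤ × ℤ
endpoint = endFrom (0ℤ , 0ℤ)

-- all points of the path started at height y, except possibly the last one,
-- lie on or above the x-axis
AboveExceptLast : ℤ → Path → Set
AboveExceptLast y []      = ⊤
AboveExceptLast y (s ∷ p) = (0ℤ ℤ.≤ y) × AboveExceptLast (y ℤ.+ dy s) p

InF : (N K m n : ℕ) → Path → Set
InF N K m n p = All (InD N K) p × endpoint p ≡ (+ n , - (+ m))

InP : (N K m n : ℕ) → Path → Set
InP N K m n p = InF N K m n p × AboveExceptLast 0ℤ p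

-- "the set {p | P p} is finite with exactly c elements":
-- there is a duplicate-free list enumerating exactly the elements satisfying P
HasCard : {A : Set} → (A → Set) → ℕ → Set
HasCard {A} P c =
  Σ (List A) λ xs → Unique xs × (∀ a → (a ∈ xs) ⇔ P a) × length xs ≡ c

sumTo : ℕ → (ℕ → ℕ) → ℕ
sumTo zero    f = f 0
sumTo (suc u) f = sumTo u f ℕ.+ f (suc u)

-- floor division a / b (only used with b ≥ 1; returns 0 for b = 0)
floorDiv : ℕ → ℕ → ℕ
floorDiv a zero    = 0
floorDiv a (suc b) = a / suc b

-- Cut a 𝒟-path before each of its slanted steps: it becomes an initial run of c₀ vertical steps
-- followed by n blocks, each a slanted step U_N or D_K followed by a run of vertical steps. If k
-- of the slanted steps are D_K, ending at height −m forces the vertical runs to have total length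
-- N n + m − k (N + K); so the slanted steps form a word with k letters D among n, and the n + 1
-- run lengths form a weak composition of that total, which is the k-th summand of |𝓕_𝒟(m,n)|.
-- A path of 𝓟_𝒟(1,n) cannot start with a vertical step, so it has only n runs, and the height
-- changes of its blocks form a sequence of sum −1 whose partial sums stay nonnegative before the
-- last one. By the cycle lemma exactly one of the n rotations of every sequence of sum −1 has
-- that property, so n |𝓟_𝒟(1,n)| is the number of block sequences of sum −1.

module Submission where

open import Defs
open import Data.Bool using (Bool; true; false)
open import Data.Nat as ℕ using (ℕ; zero; suc; _+_; _*_; _∸_; _/_; _≤_; _<_; z≤n; s≤s)
import Data.Nat.Properties as ℕₚ
open import Data.Nat.DivMod using (m/n*n≤m; m*n/n≡m; /-monoˡ-≤)
open import Data.Nat.ListAction using (sum)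
open import Data.Nat.Combinatorics using (_C_; nCn≡1; nCk+nC[k+1]≡[n+1]C[k+1])
import Data.Nat.Tactic.RingSolver as ℕ-Solver
open import Data.Integer as ℤ using (ℤ; +_; -[1+_]; 0ℤ; -1ℤ; 1ℤ)
import Data.Integer.Properties as ℤₚ
import Data.Integer.Tactic.RingSolver as ℤ-Solver
open import Data.Product using (Σ; ∃; _×_; _,_; proj₁; proj₂; map₁)
open import Data.Sum as Sum using (_⊎_; inj₁; inj₂; [_,_]′)
open import Data.Unit using (⊤; tt)
open import Data.Empty using (⊥; ⊥-elim)
open import Data.List
  using (List; []; _∷_; [_]; length; map; _++_; replicate; take; drop; foldr; zip; unzip;
         cartesianProduct; upTo; filter)
open import Data.List.Properties
  using (∷-injectiveʳ; ++-assoc; ++-identityʳ; length-++; length-map; length-take; length-drop;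
         length-upTo; length-zipWith; length-unzipWith₁; length-unzipWith₂; map-++; take-map; drop-map;
         take++drop≡id; drop-drop; take-take; take-all; drop-all; zip-unzip; unzip-zip)
open import Data.List.Relation.Unary.All using (All; []; _∷_)
open import Data.List.Relation.Unary.AllPairs using ([]; _∷_)
open import Data.List.Relation.Unary.Any using (here; there)
open import Data.List.Relation.Unary.Unique.Propositional using (Unique)
import Data.List.Relation.Unary.Unique.Propositional.Properties as Unique
open import Data.List.Membership.Propositional using (_∈_)
open import Data.List.Membership.Propositional.Properties
  using (∈-map⁺; ∈-map⁻; ∈-++⁺ˡ; ∈-++⁺ʳ; ∈-++⁻; ∈-cartesianProduct⁺; ∈-cartesianProduct⁻;
         ∈-upTo⁺; ∈-upTo⁻; ∈-filter⁺; ∈-filter⁻)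
open import Data.List.Membership.Propositional.Properties.WithK using (unique∧set⇒bag)
open import Data.List.Relation.Binary.BagAndSetEquality using (∼bag⇒↭)
open import Data.List.Relation.Binary.Permutation.Propositional.Properties using (↭-length)
open import Function using (id; _∘_)
open import Function.Bundles using (_⇔_; mk⇔; Equivalence)
import Function.Properties.Equivalence as ⇔
open import Relation.Nullary using (¬_; Dec; yes; no)
open import Relation.Nullary.Decidable using (_×-dec_)
open import Relation.Unary using (Decidable)
open import Relation.Binary.Definitions using (tri<; tri≈; tri>)
open import Relation.Binary.PropositionalEquality
  using (_≡_; refl; sym; trans; cong; cong₂; subst; module ≡-Reasoning)

open Equivalence using (to; from)

private variable
  A B : Set
  P Q : A → Set
  a b c : ℕ

-- Finite cardinalities

HasCard-unique : HasCard P a → HasCard P b → a ≡ b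
HasCard-unique (xs , xs! , ∈xs⇔ , refl) (ys , ys! , ∈ys⇔ , refl) =
  ↭-length (∼bag⇒↭ (unique∧set⇒bag xs! ys! (⇔.trans (∈xs⇔ _) (⇔.sym (∈ys⇔ _)))))

HasCard-cong : (∀ x → P x ⇔ Q x) → HasCard P c → HasCard Q c
HasCard-cong P⇔Q (xs , xs! , ∈xs⇔ , len) = xs , xs! , (λ x → ⇔.trans (∈xs⇔ x) (P⇔Q x)) , len

HasCard-singleton : (x : A) → HasCard (_≡ x) 1
HasCard-singleton x =
  [ x ] , [] ∷ [] , (λ y → mk⇔ (λ { (here y≡x) → y≡x ; (there ()) }) here) , refl

HasCard-empty : HasCard {A} (λ _ → ⊥) 0
HasCard-empty = [] , [] , (λ _ → mk⇔ (λ ()) (λ ())) , refl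

Image : (A → B) → (A → Set) → B → Set
Image f P y = ∃ λ x → P x × f x ≡ y

Unique-map⁺ : (f : A → B) {xs : List A} →
  (∀ {x y} → x ∈ xs → y ∈ xs → f x ≡ f y → x ≡ y) → Unique xs → Unique (map f xs)
Unique-map⁺ f _   []           = []
Unique-map⁺ f {x ∷ xs} inj (x∉xs ∷ xs!) =
  map-≢ x∉xs (λ y∈xs → inj (here refl) (there y∈xs)) ∷ Unique-map⁺ f (λ p q → inj (there p) (there q)) xs!
  where
  map-≢ : ∀ {ys} → All (λ y → ¬ x ≡ y) ys → (∀ {y} → y ∈ ys → f x ≡ f y → x ≡ y) →
          All (λ z → ¬ f x ≡ z) (map f ys)
  map-≢ []           _    = []
  map-≢ (x≢y ∷ x≢ys) inj′ = (λ fx≡fy → x≢y (inj′ (here refl) fx≡fy)) ∷ map-≢ x≢ys (λ p → inj′ (there p))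

HasCard-image : (f : A → B) → (∀ {x y} → P x → P y → f x ≡ f y → x ≡ y) →
  HasCard P c → HasCard (Image f P) c
HasCard-image f inj (xs , xs! , ∈xs⇔ , len) =
  map f xs ,
  Unique-map⁺ f (λ p q → inj (to (∈xs⇔ _) p) (to (∈xs⇔ _) q)) xs! ,
  (λ y → mk⇔ (λ y∈ → let (x , x∈ , y≡fx) = ∈-map⁻ f y∈ in x , to (∈xs⇔ x) x∈ , sym y≡fx)
             (λ { (x , Px , refl) → ∈-map⁺ f (from (∈xs⇔ x) Px) })) ,
  trans (length-map f xs) len

HasCard-∪ : (∀ x → P x → Q x → ⊥) → HasCard P a → HasCard Q b → HasCard (λ x → P x ⊎ Q x) (a + b)
HasCard-∪ disjoint (xs , xs! , ∈xs⇔ , refl) (ys , ys! , ∈ys⇔ , refl) =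
  xs ++ ys ,
  Unique.++⁺ xs! ys! (λ (p , q) → disjoint _ (to (∈xs⇔ _) p) (to (∈ys⇔ _) q)) ,
  (λ x → mk⇔ (λ x∈ → Sum.map (to (∈xs⇔ x)) (to (∈ys⇔ x)) (∈-++⁻ xs x∈))
             (λ { (inj₁ Px) → ∈-++⁺ˡ (from (∈xs⇔ x) Px) ; (inj₂ Qx) → ∈-++⁺ʳ xs (from (∈ys⇔ x) Qx) })) ,
  length-++ xs

length-cartesianProduct : (xs : List A) (ys : List B) →
  length (cartesianProduct xs ys) ≡ length xs * length ys
length-cartesianProduct []       ys = refl
length-cartesianProduct (x ∷ xs) ys =
  trans (length-++ (map (x ,_) ys)) (cong₂ _+_ (length-map _ ys) (length-cartesianProduct xs ys))

HasCard-× : HasCard P a → HasCard Q b → HasCard (λ (x , y) → P x × Q y) (a * b)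
HasCard-× (xs , xs! , ∈xs⇔ , refl) (ys , ys! , ∈ys⇔ , refl) =
  cartesianProduct xs ys ,
  Unique.cartesianProduct⁺ xs! ys! ,
  (λ (x , y) → mk⇔ (λ xy∈ → let (x∈ , y∈) = ∈-cartesianProduct⁻ xs ys xy∈ in to (∈xs⇔ x) x∈ , to (∈ys⇔ y) y∈)
                   (λ (Px , Qy) → ∈-cartesianProduct⁺ (from (∈xs⇔ x) Px) (from (∈ys⇔ y) Qy))) ,
  length-cartesianProduct xs ys

HasCard-< : ∀ n → HasCard (_< n) n
HasCard-< n = upTo n , Unique.upTo⁺ n , (λ i → mk⇔ ∈-upTo⁻ ∈-upTo⁺) , length-upTo n

HasCard-filter : Decidable Q → HasCard P c → ∃ λ d → HasCard (λ x → P x × Q x) d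
HasCard-filter Q? (xs , xs! , ∈xs⇔ , _) =
  _ , filter Q? xs , Unique.filter⁺ Q? xs! ,
  (λ x → mk⇔ (λ x∈ → let (x∈xs , Qx) = ∈-filter⁻ Q? x∈ in to (∈xs⇔ x) x∈xs , Qx)
             (λ (Px , Qx) → ∈-filter⁺ Q? (from (∈xs⇔ x) Px) Qx)) ,
  refl

HasCard-sumTo : (g : A → ℕ) (f : ℕ → ℕ) (u : ℕ) →
  (∀ k → k ≤ u → HasCard (λ x → P x × g x ≡ k) (f k)) →
  (∀ x → P x → g x ≤ u) → HasCard P (sumTo u f)
HasCard-sumTo {P = P} g f u fibre bounded =
  HasCard-cong (λ x → mk⇔ proj₁ (λ Px → Px , bounded x Px)) (upTo≤ u ℕₚ.≤-refl)
  where
  upTo≤ : ∀ v → v ≤ u → HasCard (λ x → P x × g x ≤ v) (sumTo v f)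
  upTo≤ zero    _   = HasCard-cong (λ x → mk⇔ (λ (Px , gx≡0) → Px , ℕₚ.≤-reflexive gx≡0)
                                             (λ (Px , gx≤0) → Px , ℕₚ.n≤0⇒n≡0 gx≤0))
                                   (fibre 0 z≤n)
  upTo≤ (suc v) v<u = HasCard-cong split
    (HasCard-∪ (λ x (_ , gx≤v) (_ , gx≡1+v) → ℕₚ.1+n≰n (subst (_≤ v) gx≡1+v gx≤v))
               (upTo≤ v (ℕₚ.<⇒≤ v<u)) (fibre (suc v) v<u))
    where
    split : ∀ x → ((P x × g x ≤ v) ⊎ (P x × g x ≡ suc v)) ⇔ (P x × g x ≤ suc v)
    split x = mk⇔ (λ { (inj₁ (Px , gx≤v))   → Px , ℕₚ.m≤n⇒m≤1+n gx≤v
                     ; (inj₂ (Px , gx≡1+v)) → Px , ℕₚ.≤-reflexive gx≡1+v })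
                  (λ (Px , gx≤1+v) → Sum.map (λ { (s≤s gx≤v) → Px , gx≤v }) (Px ,_)
                                             (ℕₚ.m≤n⇒m<n∨m≡n gx≤1+v))

sumTo-cong : ∀ u {f g : ℕ → ℕ} → (∀ k → k ≤ u → f k ≡ g k) → sumTo u f ≡ sumTo u g
sumTo-cong zero    f≡g = f≡g 0 z≤n
sumTo-cong (suc u) f≡g =
  cong₂ _+_ (sumTo-cong u (λ k k≤u → f≡g k (ℕₚ.m≤n⇒m≤1+n k≤u))) (f≡g (suc u) ℕₚ.≤-refl)

-- Binary words and weak compositions

trues : List Bool → ℕ
trues []          = 0
trues (true ∷ w)  = suc (trues w)
trues (false ∷ w) = trues w

falses : List Bool → ℕ
falses []          = 0
falses (true ∷ w)  = falses w
falses (false ∷ w) = suc (falses w)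

falses+trues≡length : ∀ w → falses w + trues w ≡ length w
falses+trues≡length []          = refl
falses+trues≡length (true ∷ w)  = trans (ℕₚ.+-suc (falses w) (trues w)) (cong suc (falses+trues≡length w))
falses+trues≡length (false ∷ w) = cong suc (falses+trues≡length w)

nC0≡1 : ∀ n → n C 0 ≡ 1
nC0≡1 zero    = refl
nC0≡1 (suc n) = refl

Word : ℕ → ℕ → List Bool → Set
Word n k w = length w ≡ n × trues w ≡ k

HasCard-Word : ∀ n k → HasCard (Word n k) (n C k)
HasCard-Word zero zero = HasCard-cong (λ where
    []      → mk⇔ (λ _ → refl , refl) (λ _ → refl)
    (_ ∷ _) → mk⇔ (λ ()) (λ { (() , _) }))
  (HasCard-singleton [])
HasCard-Word zero (suc k) = HasCard-cong (λ where
    []      → mk⇔ (λ ()) (λ { (_ , ()) })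
    (_ ∷ _) → mk⇔ (λ ()) (λ { (() , _) }))
  HasCard-empty
HasCard-Word (suc n) zero =
  subst (HasCard (Word (suc n) 0)) (trans (nC0≡1 n) (sym (nC0≡1 (suc n))))
    (HasCard-cong (λ w → mk⇔ (λ { (_ , (refl , t) , refl) → refl , t }) (falseHead w))
      (HasCard-image (false ∷_) (λ _ _ → ∷-injectiveʳ) (HasCard-Word n 0)))
  where
  falseHead : ∀ w → Word (suc n) 0 w → Image (false ∷_) (Word n 0) w
  falseHead (false ∷ w) (refl , t) = w , (refl , t) , refl
HasCard-Word (suc n) (suc k) =
  subst (HasCard (Word (suc n) (suc k))) pascal
    (HasCard-cong (λ w → mk⇔ fromHeads (toHeads w))
      (HasCard-∪ (λ { _ (_ , _ , refl) (_ , _ , ()) })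
        (HasCard-image (false ∷_) (λ _ _ → ∷-injectiveʳ) (HasCard-Word n (suc k)))
        (HasCard-image (true ∷_) (λ _ _ → ∷-injectiveʳ) (HasCard-Word n k))))
  where
  pascal : n C suc k + n C k ≡ suc n C suc k
  pascal = trans (ℕₚ.+-comm (n C suc k) (n C k)) (nCk+nC[k+1]≡[n+1]C[k+1] n k)
  fromHeads : ∀ {w} → Image (false ∷_) (Word n (suc k)) w ⊎ Image (true ∷_) (Word n k) w →
              Word (suc n) (suc k) w
  fromHeads (inj₁ (_ , (refl , t) , refl))    = refl , t
  fromHeads (inj₂ (_ , (refl , refl) , refl)) = refl , refl
  toHeads : ∀ w → Word (suc n) (suc k) w →
            Image (false ∷_) (Word n (suc k)) w ⊎ Image (true ∷_) (Word n k) w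
  toHeads (false ∷ w) (refl , t)    = inj₁ (w , (refl , t) , refl)
  toHeads (true ∷ w)  (refl , refl) = inj₂ (w , (refl , refl) , refl)

Composition : ℕ → ℕ → List ℕ → Set
Composition j s cs = length cs ≡ j × sum cs ≡ s

incrementHead : List ℕ → List ℕ
incrementHead []       = []
incrementHead (c ∷ cs) = suc c ∷ cs

incrementHead-injective : ∀ {cs ds} → incrementHead cs ≡ incrementHead ds → cs ≡ ds
incrementHead-injective {[]}    {[]}    _    = refl
incrementHead-injective {_ ∷ _} {_ ∷ _} refl = refl

HasCard-Composition : ∀ j s → HasCard (Composition (suc j) s) ((s + j) C j)
HasCard-Composition zero s =
  subst (HasCard (Composition 1 s)) (sym (nC0≡1 (s + 0)))
    (HasCard-cong (λ cs → mk⇔ (λ { refl → refl , ℕₚ.+-identityʳ s }) (singleton cs))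
      (HasCard-singleton [ s ]))
  where
  singleton : ∀ cs → Composition 1 s cs → cs ≡ [ s ]
  singleton (c ∷ []) (refl , c+0≡s) = cong [_] (trans (sym (ℕₚ.+-identityʳ c)) c+0≡s)
HasCard-Composition (suc j) zero =
  subst (HasCard (Composition (suc (suc j)) 0)) (trans (nCn≡1 j) (sym (nCn≡1 (suc j))))
    (HasCard-cong (λ cs → mk⇔ (λ { (_ , (∣cs∣≡ , sum≡) , refl) → cong suc ∣cs∣≡ , sum≡ }) (zeroHead cs))
      (HasCard-image (0 ∷_) (λ _ _ → ∷-injectiveʳ) (HasCard-Composition j 0)))
  where
  zeroHead : ∀ cs → Composition (suc (suc j)) 0 cs → Image (0 ∷_) (Composition (suc j) 0) cs
  zeroHead (zero ∷ cs) (∣cs∣≡ , sum≡) = cs , (ℕₚ.suc-injective ∣cs∣≡ , sum≡) , refl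
HasCard-Composition (suc j) (suc s) =
  subst (HasCard (Composition (suc (suc j)) (suc s))) pascal
    (HasCard-cong (λ cs → mk⇔ fromHeads (toHeads cs))
      (HasCard-∪ (λ { _ (_ , _ , refl) (_ ∷ _ , _ , ()) })
        (HasCard-image (0 ∷_) (λ _ _ → ∷-injectiveʳ) (HasCard-Composition j (suc s)))
        (HasCard-image incrementHead (λ _ _ → incrementHead-injective) (HasCard-Composition (suc j) s))))
  where
  open ≡-Reasoning
  pascal : (suc s + j) C j + (s + suc j) C suc j ≡ (suc s + suc j) C suc j
  pascal = begin
    (suc s + j) C j + (s + suc j) C suc j ≡⟨ cong (λ t → (suc s + j) C j + t C suc j) (ℕₚ.+-suc s j) ⟩
    (suc s + j) C j + (suc s + j) C suc j ≡⟨ nCk+nC[k+1]≡[n+1]C[k+1] (suc s + j) j ⟩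
    suc (suc s + j) C suc j               ≡⟨ cong (_C suc j) (ℕₚ.+-suc (suc s) j) ⟨
    (suc s + suc j) C suc j               ∎
  ZeroHead SucHead : List ℕ → Set
  ZeroHead = Image (0 ∷_) (Composition (suc j) (suc s))
  SucHead  = Image incrementHead (Composition (suc (suc j)) s)
  fromHeads : ∀ {cs} → ZeroHead cs ⊎ SucHead cs → Composition (suc (suc j)) (suc s) cs
  fromHeads (inj₁ (_ , (∣cs∣≡ , sum≡) , refl))     = cong suc ∣cs∣≡ , sum≡
  fromHeads (inj₂ (_ ∷ _ , (∣cs∣≡ , sum≡) , refl)) = ∣cs∣≡ , cong suc sum≡
  toHeads : ∀ cs → Composition (suc (suc j)) (suc s) cs → ZeroHead cs ⊎ SucHead cs
  toHeads (zero ∷ cs)  (∣cs∣≡ , sum≡) = inj₁ (cs , (ℕₚ.suc-injective ∣cs∣≡ , sum≡) , refl)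
  toHeads (suc c ∷ cs) (∣cs∣≡ , sum≡) = inj₂ (c ∷ cs , (∣cs∣≡ , ℕₚ.suc-injective sum≡) , refl)

-- Rotations and the cycle lemma

rotate : ℕ → List A → List A
rotate r xs = drop r xs ++ take r xs

length-rotate : ∀ r (xs : List A) → length (rotate r xs) ≡ length xs
length-rotate r xs = begin
  length (drop r xs ++ take r xs)         ≡⟨ length-++ (drop r xs) ⟩
  length (drop r xs) + length (take r xs) ≡⟨ ℕₚ.+-comm (length (drop r xs)) _ ⟩
  length (take r xs) + length (drop r xs) ≡⟨ length-++ (take r xs) ⟨
  length (take r xs ++ drop r xs)         ≡⟨ cong length (take++drop≡id r xs) ⟩
  length xs                               ∎
  where open ≡-Reasoning

map-rotate : (f : A → B) → ∀ r xs → map f (rotate r xs) ≡ rotate r (map f xs)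
map-rotate f r xs =
  trans (map-++ f (drop r xs) (take r xs)) (cong₂ _++_ (sym (drop-map r xs)) (sym (take-map r xs)))

rotate-zero : (xs : List A) → rotate 0 xs ≡ xs
rotate-zero = ++-identityʳ

rotate-length : (xs : List A) → rotate (length xs) xs ≡ xs
rotate-length xs = cong₂ _++_ (drop-all (length xs) xs ℕₚ.≤-refl) (take-all (length xs) xs ℕₚ.≤-refl)

drop-++ˡ : ∀ n (xs ys : List A) → n ≤ length xs → drop n (xs ++ ys) ≡ drop n xs ++ ys
drop-++ˡ zero    xs       ys _            = refl
drop-++ˡ (suc n) (x ∷ xs) ys (s≤s n≤∣xs∣) = drop-++ˡ n xs ys n≤∣xs∣

take-++ˡ : ∀ n (xs ys : List A) → n ≤ length xs → take n (xs ++ ys) ≡ take n xs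
take-++ˡ zero    xs       ys _            = refl
take-++ˡ (suc n) (x ∷ xs) ys (s≤s n≤∣xs∣) = cong (x ∷_) (take-++ˡ n xs ys n≤∣xs∣)

take-+ : ∀ i j (xs : List A) → take (i + j) xs ≡ take i xs ++ take j (drop i xs)
take-+ zero    j       xs       = refl
take-+ (suc i) zero    []       = refl
take-+ (suc i) (suc j) []       = refl
take-+ (suc i) j       (x ∷ xs) = cong (x ∷_) (take-+ i j xs)

rotate-rotate : ∀ i j (xs : List A) → i + j ≤ length xs → rotate j (rotate i xs) ≡ rotate (i + j) xs
rotate-rotate i j xs i+j≤n = begin
  drop j (drop i xs ++ take i xs) ++ take j (drop i xs ++ take i xs)
    ≡⟨ cong₂ _++_ (drop-++ˡ j (drop i xs) (take i xs) j≤) (take-++ˡ j (drop i xs) (take i xs) j≤) ⟩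
  (drop j (drop i xs) ++ take i xs) ++ take j (drop i xs)
    ≡⟨ ++-assoc (drop j (drop i xs)) (take i xs) (take j (drop i xs)) ⟩
  drop j (drop i xs) ++ (take i xs ++ take j (drop i xs))
    ≡⟨ cong₂ _++_ (drop-drop i j xs) (sym (take-+ i j xs)) ⟩
  drop (i + j) xs ++ take (i + j) xs
    ∎
  where
  open ≡-Reasoning
  j≤ : j ≤ length (drop i xs)
  j≤ = subst (j ≤_) (sym (length-drop i xs))
         (subst (_≤ length xs ∸ i) (ℕₚ.m+n∸m≡n i j) (ℕₚ.∸-monoˡ-≤ i i+j≤n))

rotate-inverse : ∀ r (xs : List A) → r ≤ length xs → rotate (length xs ∸ r) (rotate r xs) ≡ xs
rotate-inverse r xs r≤n = begin
  rotate (length xs ∸ r) (rotate r xs) ≡⟨ rotate-rotate r (length xs ∸ r) xs (ℕₚ.≤-reflexive r+[n∸r]≡n) ⟩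
  rotate (r + (length xs ∸ r)) xs      ≡⟨ cong (λ k → rotate k xs) r+[n∸r]≡n ⟩
  rotate (length xs) xs                ≡⟨ rotate-length xs ⟩
  xs                                   ∎
  where
  open ≡-Reasoning
  r+[n∸r]≡n = ℕₚ.m+[n∸m]≡n r≤n

rotate-undo : ∀ t (xs : List A) → t < length xs → ∃ λ r → r < length xs × rotate r (rotate t xs) ≡ xs
rotate-undo zero    xs 0<n = 0 , 0<n , trans (rotate-zero (rotate 0 xs)) (rotate-zero xs)
rotate-undo (suc t) xs t<n =
  length xs ∸ suc t , ℕₚ.∸-monoʳ-< (s≤s z≤n) (ℕₚ.<⇒≤ t<n) , rotate-inverse (suc t) xs (ℕₚ.<⇒≤ t<n)

rotate-injective : ∀ r (xs ys : List A) → length xs ≡ length ys → r ≤ length xs →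
  rotate r xs ≡ rotate r ys → xs ≡ ys
rotate-injective r xs ys ∣xs∣≡∣ys∣ r≤∣xs∣ eq = begin
  xs                                   ≡⟨ rotate-inverse r xs r≤∣xs∣ ⟨
  rotate (length xs ∸ r) (rotate r xs) ≡⟨ cong₂ (λ k zs → rotate (k ∸ r) zs) ∣xs∣≡∣ys∣ eq ⟩
  rotate (length ys ∸ r) (rotate r ys) ≡⟨ rotate-inverse r ys (subst (r ≤_) ∣xs∣≡∣ys∣ r≤∣xs∣) ⟩
  ys                                   ∎
  where open ≡-Reasoning

rotate-difference : ∀ r s (xs ys : List A) → length xs ≡ length ys → r ≤ s → s ≤ length ys →
  rotate r xs ≡ rotate s ys → ys ≡ rotate (r + (length ys ∸ s)) xs
rotate-difference r s xs ys ∣xs∣≡∣ys∣ r≤s s≤∣ys∣ eq = begin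
  ys                                   ≡⟨ rotate-inverse s ys s≤∣ys∣ ⟨
  rotate (length ys ∸ s) (rotate s ys) ≡⟨ cong (rotate (length ys ∸ s)) eq ⟨
  rotate (length ys ∸ s) (rotate r xs) ≡⟨ rotate-rotate r (length ys ∸ s) xs bound ⟩
  rotate (r + (length ys ∸ s)) xs      ∎
  where
  open ≡-Reasoning
  bound : r + (length ys ∸ s) ≤ length xs
  bound = subst (r + (length ys ∸ s) ≤_) (trans (ℕₚ.m+[n∸m]≡n s≤∣ys∣) (sym ∣xs∣≡∣ys∣))
            (ℕₚ.+-monoˡ-≤ (length ys ∸ s) r≤s)

sumℤ : List ℤ → ℤ
sumℤ = foldr ℤ._+_ 0ℤ

sumℤ-++ : ∀ xs ys → sumℤ (xs ++ ys) ≡ sumℤ xs ℤ.+ sumℤ ys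
sumℤ-++ []       ys = sym (ℤₚ.+-identityˡ (sumℤ ys))
sumℤ-++ (x ∷ xs) ys = trans (cong (λ s → x ℤ.+ s) (sumℤ-++ xs ys)) (sym (ℤₚ.+-assoc x (sumℤ xs) (sumℤ ys)))

sumℤ-take+drop : ∀ r xs → sumℤ (take r xs) ℤ.+ sumℤ (drop r xs) ≡ sumℤ xs
sumℤ-take+drop r xs = trans (sym (sumℤ-++ (take r xs) (drop r xs))) (cong sumℤ (take++drop≡id r xs))

sumℤ-rotate : ∀ r xs → sumℤ (rotate r xs) ≡ sumℤ xs
sumℤ-rotate r xs =
  trans (sumℤ-++ (drop r xs) (take r xs)) (trans (ℤₚ.+-comm (sumℤ (drop r xs)) _) (sumℤ-take+drop r xs))

NonnegWalk : ℤ → List ℤ → Set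
NonnegWalk y []       = ⊤
NonnegWalk y (z ∷ zs) = 0ℤ ℤ.≤ y × NonnegWalk (y ℤ.+ z) zs

NonnegWalk? : ∀ y zs → Dec (NonnegWalk y zs)
NonnegWalk? y []       = yes tt
NonnegWalk? y (z ∷ zs) = (0ℤ ℤₚ.≤? y) ×-dec NonnegWalk? (y ℤ.+ z) zs

NonnegWalk-++⁻ : ∀ y xs ys → NonnegWalk y (xs ++ ys) → NonnegWalk y xs × NonnegWalk (y ℤ.+ sumℤ xs) ys
NonnegWalk-++⁻ y []       ys walk          = tt , subst (λ h → NonnegWalk h ys) (sym (ℤₚ.+-identityʳ y)) walk
NonnegWalk-++⁻ y (x ∷ xs) ys (0≤y , walk) =
  let (walk-xs , walk-ys) = NonnegWalk-++⁻ (y ℤ.+ x) xs ys walk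
  in (0≤y , walk-xs) , subst (λ h → NonnegWalk h ys) (ℤₚ.+-assoc y x (sumℤ xs)) walk-ys

NonnegWalk-++⁺ : ∀ y xs ys → NonnegWalk y xs → NonnegWalk (y ℤ.+ sumℤ xs) ys → NonnegWalk y (xs ++ ys)
NonnegWalk-++⁺ y []       ys _               walk-ys = subst (λ h → NonnegWalk h ys) (ℤₚ.+-identityʳ y) walk-ys
NonnegWalk-++⁺ y (x ∷ xs) ys (0≤y , walk-xs) walk-ys =
  0≤y , NonnegWalk-++⁺ (y ℤ.+ x) xs ys walk-xs
          (subst (λ h → NonnegWalk h ys) (sym (ℤₚ.+-assoc y x (sumℤ xs))) walk-ys)

NonnegWalk-fromPrefixes : ∀ y xs → (∀ i → i < length xs → 0ℤ ℤ.≤ y ℤ.+ sumℤ (take i xs)) → NonnegWalk y xs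
NonnegWalk-fromPrefixes y []       _       = tt
NonnegWalk-fromPrefixes y (x ∷ xs) heights =
  subst (0ℤ ℤ.≤_) (ℤₚ.+-identityʳ y) (heights 0 (s≤s z≤n)) ,
  NonnegWalk-fromPrefixes (y ℤ.+ x) xs
    (λ i i<n → subst (0ℤ ℤ.≤_) (sym (ℤₚ.+-assoc y x _)) (heights (suc i) (s≤s i<n)))

NonnegWalk⇒0≤sumℤ-prefix : ∀ xs ys → 0 < length ys → NonnegWalk 0ℤ (xs ++ ys) → 0ℤ ℤ.≤ sumℤ xs
NonnegWalk⇒0≤sumℤ-prefix xs (y ∷ ys) _ walk =
  subst (0ℤ ℤ.≤_) (ℤₚ.+-identityˡ _) (proj₁ (proj₂ (NonnegWalk-++⁻ 0ℤ xs (y ∷ ys) walk)))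

NonnegWalk⇒-1≤start : ∀ y zs → NonnegWalk y zs → -1ℤ ℤ.≤ y ℤ.+ sumℤ zs → -1ℤ ℤ.≤ y
NonnegWalk⇒-1≤start y []      _         -1≤end = subst (-1ℤ ℤ.≤_) (ℤₚ.+-identityʳ y) -1≤end
NonnegWalk⇒-1≤start y (_ ∷ _) (0≤y , _) _      = ℤₚ.≤-trans ℤ.-≤+ 0≤y

-- Cut at 0 and at d, both arcs would have nonnegative sum, whereas the two sums add up to −1.
NonnegWalk-rotate-unique : ∀ zs d → NonnegWalk 0ℤ zs → sumℤ zs ≡ -1ℤ →
  0 < d → d < length zs → ¬ NonnegWalk 0ℤ (rotate d zs)
NonnegWalk-rotate-unique zs d walk sum≡-1 0<d d<n walk-rotated =
  0≰-1 (subst (0ℤ ℤ.≤_) (trans (sumℤ-take+drop d zs) sum≡-1) (ℤₚ.+-mono-≤ 0≤init 0≤tail))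
  where
  0≰-1 : ¬ (0ℤ ℤ.≤ -1ℤ)
  0≰-1 ()
  0≤init : 0ℤ ℤ.≤ sumℤ (take d zs)
  0≤init = NonnegWalk⇒0≤sumℤ-prefix (take d zs) (drop d zs)
             (subst (0 <_) (sym (length-drop d zs)) (ℕₚ.m<n⇒0<n∸m d<n))
             (subst (NonnegWalk 0ℤ) (sym (take++drop≡id d zs)) walk)
  0≤tail : 0ℤ ℤ.≤ sumℤ (drop d zs)
  0≤tail = NonnegWalk⇒0≤sumℤ-prefix (drop d zs) (take d zs)
             (subst (0 <_) (sym (trans (length-take d zs) (ℕₚ.m≤n⇒m⊓n≡m (ℕₚ.<⇒≤ d<n)))) 0<d)
             walk-rotated

firstMinimum : (f : ℕ → ℤ) → ∀ m → 0 < m →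
  ∃ λ t → t < m × (∀ i → i < t → f t ℤ.< f i) × (∀ i → i < m → f t ℤ.≤ f i)
firstMinimum f (suc zero) _ = 0 , s≤s z≤n , (λ _ ()) , λ { zero _ → ℤₚ.≤-refl ; (suc _) (s≤s ()) }
firstMinimum f (suc (suc m)) _ with firstMinimum f (suc m) (s≤s z≤n)
... | t , t<m , before , below with f (suc m) ℤₚ.<? f t
...   | yes new = suc m , ℕₚ.≤-refl , (λ i i<m → ℤₚ.<-≤-trans new (below i i<m)) , λ i i<2+m →
          [ (λ i<1+m → ℤₚ.<⇒≤ (ℤₚ.<-≤-trans new (below i i<1+m))) , (λ { refl → ℤₚ.≤-refl }) ]′
            (ℕₚ.m<1+n⇒m<n∨m≡n i<2+m)
...   | no old = t , ℕₚ.m≤n⇒m≤1+n t<m , before , λ i i<2+m →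
          [ below i , (λ { refl → ℤₚ.≮⇒≥ old }) ]′ (ℕₚ.m<1+n⇒m<n∨m≡n i<2+m)

private
  [i+j]-i≡0+j : ∀ i j → (i ℤ.+ j) ℤ.- i ≡ 0ℤ ℤ.+ j
  [i+j]-i≡0+j = ℤ-Solver.solve-∀
  [i+j]+1≡j+[1+i] : ∀ i j → (i ℤ.+ j) ℤ.+ 1ℤ ≡ j ℤ.+ (1ℤ ℤ.+ i)
  [i+j]+1≡j+[1+i] = ℤ-Solver.solve-∀

-- Rotate so as to start at the first minimum of the prefix sums.
NonnegWalk-rotate-exists : ∀ zs → 0 < length zs → sumℤ zs ≡ -1ℤ →
  ∃ λ t → t < length zs × NonnegWalk 0ℤ (rotate t zs)
NonnegWalk-rotate-exists zs 0<n sum≡-1 with firstMinimum (λ i → sumℤ (take i zs)) (length zs) 0<n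
... | t , t<n , before , below = t , t<n , NonnegWalk-++⁺ 0ℤ (drop t zs) (take t zs) tailWalk initWalk
  where
  open ℤₚ.≤-Reasoning
  prefix : ℕ → ℤ
  prefix i = sumℤ (take i zs)
  tail = sumℤ (drop t zs)

  tailWalk : NonnegWalk 0ℤ (drop t zs)
  tailWalk = NonnegWalk-fromPrefixes 0ℤ (drop t zs) λ i i<∣tail∣ → begin
    0ℤ                                                    ≤⟨ ℤₚ.i≤j⇒0≤j-i (below (t + i) (t+i<n i<∣tail∣)) ⟩
    prefix (t + i) ℤ.- prefix t                           ≡⟨ cong (ℤ._- prefix t) (split i) ⟩
    (prefix t ℤ.+ sumℤ (take i (drop t zs))) ℤ.- prefix t ≡⟨ [i+j]-i≡0+j (prefix t) _ ⟩
    0ℤ ℤ.+ sumℤ (take i (drop t zs))                      ∎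
    where
    split : ∀ i → prefix (t + i) ≡ prefix t ℤ.+ sumℤ (take i (drop t zs))
    split i = trans (cong sumℤ (take-+ t i zs)) (sumℤ-++ (take t zs) _)
    t+i<n : ∀ {i} → i < length (drop t zs) → t + i < length zs
    t+i<n {i} i<∣tail∣ = subst (t + i <_) (ℕₚ.m+[n∸m]≡n (ℕₚ.<⇒≤ t<n))
                           (ℕₚ.+-monoʳ-< t (subst (i <_) (length-drop t zs) i<∣tail∣))

  initWalk : NonnegWalk (0ℤ ℤ.+ tail) (take t zs)
  initWalk = NonnegWalk-fromPrefixes (0ℤ ℤ.+ tail) (take t zs) λ i i<∣init∣ →
    let i<t = subst (i <_) (trans (length-take t zs) (ℕₚ.m≤n⇒m⊓n≡m (ℕₚ.<⇒≤ t<n))) i<∣init∣ in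
    begin
    0ℤ                                         ≡⟨ cong (ℤ._+ 1ℤ) (trans (sumℤ-take+drop t zs) sum≡-1) ⟨
    (prefix t ℤ.+ tail) ℤ.+ 1ℤ                 ≡⟨ [i+j]+1≡j+[1+i] (prefix t) tail ⟩
    tail ℤ.+ (1ℤ ℤ.+ prefix t)                 ≤⟨ ℤₚ.+-monoʳ-≤ tail (ℤₚ.i<j⇒suc[i]≤j (before i i<t)) ⟩
    tail ℤ.+ prefix i                          ≡⟨ cong₂ ℤ._+_ (ℤₚ.+-identityˡ tail) (cong sumℤ (takeTake i<t)) ⟨
    (0ℤ ℤ.+ tail) ℤ.+ sumℤ (take i (take t zs)) ∎
    where
    takeTake : ∀ {i} → i < t → take i (take t zs) ≡ take i zs
    takeTake {i} i<t = trans (take-take i t zs) (cong (λ k → take k zs) (ℕₚ.m≤n⇒m⊓n≡m (ℕₚ.<⇒≤ i<t)))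

module _ (weight : A → ℤ) where

  Bridge : ℕ → List A → Set
  Bridge n xs = length xs ≡ n × sumℤ (map weight xs) ≡ -1ℤ

  NonnegBridge : ℕ → List A → Set
  NonnegBridge n xs = Bridge n xs × NonnegWalk 0ℤ (map weight xs)

  Bridge-rotate : ∀ {n} r {xs} → Bridge n xs → Bridge n (rotate r xs)
  Bridge-rotate r {xs} (∣xs∣≡n , sum≡-1) =
    trans (length-rotate r xs) ∣xs∣≡n ,
    trans (cong sumℤ (map-rotate weight r xs)) (trans (sumℤ-rotate r (map weight xs)) sum≡-1)

  -- The cycle lemma, in counting form.
  HasCard-Bridge : ∀ {n} → 0 < n → HasCard (NonnegBridge n) c → HasCard (Bridge n) (c * n)
  HasCard-Bridge {n = n} 0<n nonneg =
    HasCard-cong (λ ys → mk⇔ (λ { ((xs , r) , ((bridge , _) , _) , refl) → Bridge-rotate r bridge })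
                             (rotationOfNonneg ys))
      (HasCard-image (λ (xs , r) → rotate r xs) injective (HasCard-× nonneg (HasCard-< n)))
    where
    rotationOfNonneg : ∀ ys → Bridge n ys →
      Image (λ (xs , r) → rotate r xs) (λ (xs , r) → NonnegBridge n xs × r < n) ys
    rotationOfNonneg ys bridge@(refl , sum≡-1)
      with NonnegWalk-rotate-exists (map weight ys) (subst (0 <_) (sym (length-map weight ys)) 0<n) sum≡-1
    ... | t , t<n , walk with rotate-undo t ys (subst (t <_) (length-map weight ys) t<n)
    ... | r , r<n , undo =
      (rotate t ys , r) ,
      ((Bridge-rotate t bridge , subst (NonnegWalk 0ℤ) (sym (map-rotate weight t ys)) walk) , r<n) ,
      undo

    distinct : ∀ r s xs ys → NonnegBridge n xs → NonnegBridge n ys → r < s → s < n → rotate r xs ≡ rotate s ys → ⊥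
    distinct r s xs ys ((∣xs∣≡n , sum≡-1) , walk) ((∣ys∣≡n , _) , walk′) r<s s<n eq =
      NonnegWalk-rotate-unique (map weight xs) d walk sum≡-1 0<d d<∣xs∣
        (subst (NonnegWalk 0ℤ) (trans (cong (map weight) ys≡) (map-rotate weight d xs)) walk′)
      where
      d = r + (n ∸ s)
      ys≡ : ys ≡ rotate d xs
      ys≡ = subst (λ k → ys ≡ rotate (r + (k ∸ s)) xs) ∣ys∣≡n
              (rotate-difference r s xs ys (trans ∣xs∣≡n (sym ∣ys∣≡n)) (ℕₚ.<⇒≤ r<s)
                 (subst (s ≤_) (sym ∣ys∣≡n) (ℕₚ.<⇒≤ s<n)) eq)
      0<d : 0 < d
      0<d = ℕₚ.<-≤-trans (ℕₚ.m<n⇒0<n∸m s<n) (ℕₚ.m≤n+m (n ∸ s) r)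
      d<∣xs∣ : d < length (map weight xs)
      d<∣xs∣ = subst (d <_) (sym (trans (length-map weight xs) ∣xs∣≡n))
                 (subst (d <_) (ℕₚ.m+[n∸m]≡n (ℕₚ.<⇒≤ s<n)) (ℕₚ.+-monoˡ-< (n ∸ s) r<s))

    injective : ∀ {p q : List A × ℕ} →
      NonnegBridge n (proj₁ p) × proj₂ p < n → NonnegBridge n (proj₁ q) × proj₂ q < n →
      rotate (proj₂ p) (proj₁ p) ≡ rotate (proj₂ q) (proj₁ q) → p ≡ q
    injective {xs , r} {ys , s} (nonneg-xs , r<n) (nonneg-ys , s<n) eq with ℕₚ.<-cmp r s
    ... | tri< r<s _ _ = ⊥-elim (distinct r s xs ys nonneg-xs nonneg-ys r<s s<n eq)
    ... | tri> _ _ s<r = ⊥-elim (distinct s r ys xs nonneg-ys nonneg-xs s<r r<n (sym eq))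
    ... | tri≈ _ refl _ =
      cong (_, r) (rotate-injective r xs ys (trans ∣xs∣≡n (sym ∣ys∣≡n)) (subst (r ≤_) (sym ∣xs∣≡n) (ℕₚ.<⇒≤ r<n)) eq)
      where
      ∣xs∣≡n = proj₁ (proj₁ nonneg-xs)
      ∣ys∣≡n = proj₁ (proj₁ nonneg-ys)

+≡⇔≡∸ : ∀ {m n o} → n ≤ o → (m + n ≡ o) ⇔ (m ≡ o ∸ n)
+≡⇔≡∸ {m} {n} n≤o = mk⇔ (λ m+n≡o → trans (sym (ℕₚ.m+n∸n≡m m n)) (cong (_∸ n) m+n≡o))
                         (λ m≡o∸n → trans (cong (_+ n) m≡o∸n) (ℕₚ.m∸n+n≡m n≤o))

private
  regroup : ∀ s b c m → (s ℤ.+ b) ℤ.+ m ≡ ((ℤ.- c ℤ.+ s) ℤ.+ m) ℤ.+ (c ℤ.+ b)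
  regroup = ℤ-Solver.solve-∀
  shift : ∀ s b c → ℤ.- c ℤ.+ s ≡ (s ℤ.+ b) ℤ.- (c ℤ.+ b)
  shift = ℤ-Solver.solve-∀
  i-[i+j]≡-j : ∀ i j → i ℤ.- (i ℤ.+ j) ≡ ℤ.- j
  i-[i+j]≡-j = ℤ-Solver.solve-∀

offset⇔ : ∀ (s : ℤ) (a b c m : ℕ) → s ℤ.+ + b ≡ + a → (ℤ.- + c ℤ.+ s ≡ ℤ.- + m) ⇔ (a + m ≡ c + b)
offset⇔ s a b c m s+b≡a = mk⇔
  (λ below → ℤₚ.+-injective (begin
    + (a + m)                                     ≡⟨ ℤₚ.pos-+ a m ⟩
    + a ℤ.+ + m                                   ≡⟨ cong (ℤ._+ + m) s+b≡a ⟨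
    (s ℤ.+ + b) ℤ.+ + m                           ≡⟨ regroup s (+ b) (+ c) (+ m) ⟩
    ((ℤ.- + c ℤ.+ s) ℤ.+ + m) ℤ.+ (+ c ℤ.+ + b)   ≡⟨ cong (λ h → (h ℤ.+ + m) ℤ.+ (+ c ℤ.+ + b)) below ⟩
    (ℤ.- + m ℤ.+ + m) ℤ.+ (+ c ℤ.+ + b)           ≡⟨ cong (ℤ._+ (+ c ℤ.+ + b)) (ℤₚ.+-inverseˡ (+ m)) ⟩
    0ℤ ℤ.+ (+ c ℤ.+ + b)                          ≡⟨ ℤₚ.+-identityˡ _ ⟩
    + c ℤ.+ + b                                   ≡⟨ ℤₚ.pos-+ c b ⟨
    + (c + b)                                     ∎))
  (λ a+m≡c+b → begin
    ℤ.- + c ℤ.+ s                                 ≡⟨ shift s (+ b) (+ c) ⟩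
    (s ℤ.+ + b) ℤ.- (+ c ℤ.+ + b)                 ≡⟨ cong₂ ℤ._-_ s+b≡a (c+b≡a+m a+m≡c+b) ⟩
    + a ℤ.- (+ a ℤ.+ + m)                         ≡⟨ i-[i+j]≡-j (+ a) (+ m) ⟩
    ℤ.- + m                                       ∎)
  where
  open ≡-Reasoning
  c+b≡a+m : a + m ≡ c + b → + c ℤ.+ + b ≡ + a ℤ.+ + m
  c+b≡a+m a+m≡c+b = trans (sym (ℤₚ.pos-+ c b)) (trans (cong +_ (sym a+m≡c+b)) (ℤₚ.pos-+ a m))

zip-injective : ∀ {xs xs′ : List A} {ys ys′ : List B} →
  length xs ≡ length ys → length xs′ ≡ length ys′ → zip xs ys ≡ zip xs′ ys′ → (xs , ys) ≡ (xs′ , ys′)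
zip-injective {xs = xs} {xs′} {ys} {ys′} ∣xs∣≡∣ys∣ ∣xs′∣≡∣ys′∣ eq =
  trans (sym (unzip-zip xs ys ∣xs∣≡∣ys∣)) (trans (cong unzip eq) (unzip-zip xs′ ys′ ∣xs′∣≡∣ys′∣))

length-zip : ∀ {n} (xs : List A) (ys : List B) → length xs ≡ n → length ys ≡ n → length (zip xs ys) ≡ n
length-zip {n = n} xs ys ∣xs∣≡n ∣ys∣≡n =
  trans (length-zipWith _,_ xs ys) (trans (cong₂ ℕ._⊓_ ∣xs∣≡n ∣ys∣≡n) (ℕₚ.⊓-idem n))

-- Decomposition of 𝒟-paths into blocks

-- N′ = N − 1 and K′ = K − 1: decode tells D K from U N by the sign of the slope, which needs
-- K ≥ 1, and N ≥ 1 makes N + K a successor, as the divisor of _/_ must be.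
module Enumeration (N′ K′ : ℕ) where

  N K : ℕ
  N = suc N′
  K = suc K′

  slope : Bool → Step
  slope false = U N
  slope true  = D K

  Block : Set
  Block = Bool × ℕ

  verticalRun : ℕ → Path
  verticalRun c = replicate c V

  blocksPath : List Block → Path
  blocksPath []             = []
  blocksPath ((b , c) ∷ bs) = slope b ∷ verticalRun c ++ blocksPath bs

  encode : ℕ × List Block → Path
  encode (c₀ , bs) = verticalRun c₀ ++ blocksPath bs

  isDown : ℤ → Bool
  isDown (+ _)    = false
  isDown -[1+ _ ] = true

  -- The initial vertical run of the rest of the path is the run of the block a slanted step opens.
  startBlock : Bool → ℕ × List Block → ℕ × List Block
  startBlock b (c , bs) = 0 , (b , c) ∷ bs

  decode : Path → ℕ × List Block
  decode []        = 0 , []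
  decode (V ∷ p)   = map₁ suc (decode p)
  decode (S z ∷ p) = startBlock (isDown z) (decode p)

  decode-encode : ∀ c₀ bs → decode (encode (c₀ , bs)) ≡ (c₀ , bs)
  decode-encode (suc c₀) bs                 = cong (map₁ suc) (decode-encode c₀ bs)
  decode-encode zero     []                 = refl
  decode-encode zero     ((false , c) ∷ bs) = cong (startBlock false) (decode-encode c bs)
  decode-encode zero     ((true  , c) ∷ bs) = cong (startBlock true) (decode-encode c bs)

  encode-injective : ∀ {x y} → encode x ≡ encode y → x ≡ y
  encode-injective {c₀ , bs} {d₀ , ds} eq =
    trans (sym (decode-encode c₀ bs)) (trans (cong decode eq) (decode-encode d₀ ds))

  encode-decode : ∀ p → All (InD N K) p → encode (decode p) ≡ p
  encode-decode []      []         = refl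
  encode-decode (V ∷ p) (isV ∷ ps) = cong (V ∷_) (encode-decode p ps)
  encode-decode (_ ∷ p) (isU ∷ ps) = cong (U N ∷_) (encode-decode p ps)
  encode-decode (_ ∷ p) (isD ∷ ps) = cong (D K ∷_) (encode-decode p ps)

  All-encode : ∀ c₀ bs → All (InD N K) (encode (c₀ , bs))
  All-encode (suc c₀) bs             = isV ∷ All-encode c₀ bs
  All-encode zero     []             = []
  All-encode zero     ((b , c) ∷ bs) = slope∈𝒟 b ∷ All-encode c bs
    where
    slope∈𝒟 : ∀ b → InD N K (slope b)
    slope∈𝒟 false = isU
    slope∈𝒟 true  = isD

  weight : Block → ℤ
  weight (b , c) = dy (slope b) ℤ.- + c

  endFrom-++ : ∀ q p p′ → endFrom q (p ++ p′) ≡ endFrom (endFrom q p) p′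
  endFrom-++ q       []      p′ = refl
  endFrom-++ (x , y) (s ∷ p) p′ = endFrom-++ _ p p′

  private
    [i-1]-j≡i-[1+j] : ∀ i j → (i ℤ.+ -1ℤ) ℤ.- j ≡ i ℤ.- (1ℤ ℤ.+ j)
    [i-1]-j≡i-[1+j] = ℤ-Solver.solve-∀
    [i-j]+j≡i : ∀ i j → (i ℤ.- j) ℤ.+ j ≡ i
    [i-j]+j≡i = ℤ-Solver.solve-∀

  [y-1]-c≡y-[1+c] : ∀ y c → (y ℤ.+ -1ℤ) ℤ.- + c ≡ y ℤ.- + suc c
  [y-1]-c≡y-[1+c] y c = trans ([i-1]-j≡i-[1+j] y (+ c)) (cong (λ k → y ℤ.- k) (sym (ℤₚ.pos-+ 1 c)))

  endFrom-verticalRun : ∀ x y c → endFrom (x , y) (verticalRun c) ≡ (x , y ℤ.- + c)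
  endFrom-verticalRun x y zero    = cong (x ,_) (sym (ℤₚ.+-identityʳ y))
  endFrom-verticalRun x y (suc c) =
    trans (endFrom-verticalRun (x ℤ.+ 0ℤ) (y ℤ.+ -1ℤ) c) (cong₂ _,_ (ℤₚ.+-identityʳ x) ([y-1]-c≡y-[1+c] y c))

  dx-slope : ∀ b → dx (slope b) ≡ 1ℤ
  dx-slope false = refl
  dx-slope true  = refl

  endFrom-blocksPath : ∀ x y bs →
    endFrom (x , y) (blocksPath bs) ≡ (x ℤ.+ + length bs , y ℤ.+ sumℤ (map weight bs))
  endFrom-blocksPath x y []             = sym (cong₂ _,_ (ℤₚ.+-identityʳ x) (ℤₚ.+-identityʳ y))
  endFrom-blocksPath x y ((b , c) ∷ bs) = begin
    endFrom (x ℤ.+ dx (slope b) , y ℤ.+ dy (slope b)) (verticalRun c ++ blocksPath bs)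
      ≡⟨ endFrom-++ _ (verticalRun c) (blocksPath bs) ⟩
    endFrom (endFrom (x ℤ.+ dx (slope b) , y ℤ.+ dy (slope b)) (verticalRun c)) (blocksPath bs)
      ≡⟨ cong (λ q → endFrom q (blocksPath bs)) (endFrom-verticalRun _ _ c) ⟩
    endFrom (x ℤ.+ dx (slope b) , (y ℤ.+ dy (slope b)) ℤ.- + c) (blocksPath bs)
      ≡⟨ endFrom-blocksPath _ _ bs ⟩
    ((x ℤ.+ dx (slope b)) ℤ.+ + length bs , ((y ℤ.+ dy (slope b)) ℤ.- + c) ℤ.+ rest)
      ≡⟨ cong₂ _,_ abscissa ordinate ⟩
    (x ℤ.+ + suc (length bs) , y ℤ.+ (weight (b , c) ℤ.+ rest))
      ∎
    where
    open ≡-Reasoning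
    rest = sumℤ (map weight bs)
    abscissa : (x ℤ.+ dx (slope b)) ℤ.+ + length bs ≡ x ℤ.+ + suc (length bs)
    abscissa = trans (cong (λ d → (x ℤ.+ d) ℤ.+ + length bs) (dx-slope b))
                 (trans (ℤₚ.+-assoc x 1ℤ (+ length bs)) (cong (λ l → x ℤ.+ l) (sym (ℤₚ.pos-+ 1 (length bs)))))
    ordinate : ((y ℤ.+ dy (slope b)) ℤ.- + c) ℤ.+ rest ≡ y ℤ.+ (weight (b , c) ℤ.+ rest)
    ordinate = trans (cong (ℤ._+ rest) (ℤₚ.+-assoc y (dy (slope b)) (ℤ.- + c)))
                 (ℤₚ.+-assoc y (weight (b , c)) rest)

  endpoint-encode : ∀ c₀ bs → endpoint (encode (c₀ , bs)) ≡ (+ length bs , ℤ.- + c₀ ℤ.+ sumℤ (map weight bs))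
  endpoint-encode c₀ bs = begin
    endFrom (0ℤ , 0ℤ) (verticalRun c₀ ++ blocksPath bs)
      ≡⟨ endFrom-++ _ (verticalRun c₀) (blocksPath bs) ⟩
    endFrom (endFrom (0ℤ , 0ℤ) (verticalRun c₀)) (blocksPath bs)
      ≡⟨ cong (λ q → endFrom q (blocksPath bs)) (endFrom-verticalRun 0ℤ 0ℤ c₀) ⟩
    endFrom (0ℤ , 0ℤ ℤ.- + c₀) (blocksPath bs)
      ≡⟨ endFrom-blocksPath 0ℤ (0ℤ ℤ.- + c₀) bs ⟩
    (+ length bs , (0ℤ ℤ.- + c₀) ℤ.+ sumℤ (map weight bs))
      ≡⟨ cong (λ h → + length bs , h ℤ.+ sumℤ (map weight bs)) (ℤₚ.+-identityˡ (ℤ.- + c₀)) ⟩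
    (+ length bs , ℤ.- + c₀ ℤ.+ sumℤ (map weight bs))
      ∎
    where open ≡-Reasoning

  private
    rise-step : ∀ (n c s t r : ℤ) → ((n ℤ.- c) ℤ.+ s) ℤ.+ (t ℤ.+ (c ℤ.+ r)) ≡ n ℤ.+ (s ℤ.+ (t ℤ.+ r))
    rise-step = ℤ-Solver.solve-∀
    fall-step : ∀ (k c s t r : ℤ) → ((ℤ.- k ℤ.- c) ℤ.+ s) ℤ.+ ((k ℤ.+ t) ℤ.+ (c ℤ.+ r)) ≡ s ℤ.+ (t ℤ.+ r)
    fall-step = ℤ-Solver.solve-∀

  sumℤ-weights : ∀ bs → let (w , cs) = unzip bs in
    sumℤ (map weight bs) ℤ.+ + (trues w * K + sum cs) ≡ + (falses w * N)
  sumℤ-weights [] = refl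
  sumℤ-weights ((false , c) ∷ bs) = begin
    ((+ N ℤ.- + c) ℤ.+ σ) ℤ.+ + (T + (c + s))         ≡⟨ cong (λ h → ((+ N ℤ.- + c) ℤ.+ σ) ℤ.+ h) pos-+₂ ⟩
    ((+ N ℤ.- + c) ℤ.+ σ) ℤ.+ (+ T ℤ.+ (+ c ℤ.+ + s)) ≡⟨ rise-step (+ N) (+ c) σ (+ T) (+ s) ⟩
    + N ℤ.+ (σ ℤ.+ (+ T ℤ.+ + s))                     ≡⟨ cong (λ h → + N ℤ.+ (σ ℤ.+ h)) (ℤₚ.pos-+ T s) ⟨
    + N ℤ.+ (σ ℤ.+ + (T + s))                         ≡⟨ cong (λ h → + N ℤ.+ h) (sumℤ-weights bs) ⟩
    + N ℤ.+ + (falses (proj₁ (unzip bs)) * N)         ≡⟨ ℤₚ.pos-+ N _ ⟨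
    + (N + falses (proj₁ (unzip bs)) * N)             ∎
    where
    open ≡-Reasoning
    σ = sumℤ (map weight bs)
    T = trues (proj₁ (unzip bs)) * K
    s = sum (proj₂ (unzip bs))
    pos-+₂ : + (T + (c + s)) ≡ + T ℤ.+ (+ c ℤ.+ + s)
    pos-+₂ = trans (ℤₚ.pos-+ T _) (cong (λ h → + T ℤ.+ h) (ℤₚ.pos-+ c s))
  sumℤ-weights ((true , c) ∷ bs) = begin
    ((ℤ.- + K ℤ.- + c) ℤ.+ σ) ℤ.+ + ((K + T) + (c + s))
      ≡⟨ cong (λ h → ((ℤ.- + K ℤ.- + c) ℤ.+ σ) ℤ.+ h) pos-+₃ ⟩
    ((ℤ.- + K ℤ.- + c) ℤ.+ σ) ℤ.+ ((+ K ℤ.+ + T) ℤ.+ (+ c ℤ.+ + s))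
      ≡⟨ fall-step (+ K) (+ c) σ (+ T) (+ s) ⟩
    σ ℤ.+ (+ T ℤ.+ + s)
      ≡⟨ cong (λ h → σ ℤ.+ h) (ℤₚ.pos-+ T s) ⟨
    σ ℤ.+ + (T + s)
      ≡⟨ sumℤ-weights bs ⟩
    + (falses (proj₁ (unzip bs)) * N)
      ∎
    where
    open ≡-Reasoning
    σ = sumℤ (map weight bs)
    T = trues (proj₁ (unzip bs)) * K
    s = sum (proj₂ (unzip bs))
    pos-+₃ : + ((K + T) + (c + s)) ≡ (+ K ℤ.+ + T) ℤ.+ (+ c ℤ.+ + s)
    pos-+₃ = trans (ℤₚ.pos-+ (K + T) _) (cong₂ ℤ._+_ (ℤₚ.pos-+ K T) (ℤₚ.pos-+ c s))

  AboveExceptLast-verticalRun⁻ : ∀ y c rest →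
    AboveExceptLast y (verticalRun c ++ rest) → AboveExceptLast (y ℤ.- + c) rest
  AboveExceptLast-verticalRun⁻ y zero    rest above       =
    subst (λ h → AboveExceptLast h rest) (sym (ℤₚ.+-identityʳ y)) above
  AboveExceptLast-verticalRun⁻ y (suc c) rest (_ , above) =
    subst (λ h → AboveExceptLast h rest) ([y-1]-c≡y-[1+c] y c) (AboveExceptLast-verticalRun⁻ (y ℤ.+ -1ℤ) c rest above)

  AboveExceptLast-verticalRun⁺ : ∀ y c rest → -1ℤ ℤ.≤ y ℤ.- + c →
    AboveExceptLast (y ℤ.- + c) rest → AboveExceptLast y (verticalRun c ++ rest)
  AboveExceptLast-verticalRun⁺ y zero    rest _      above =
    subst (λ h → AboveExceptLast h rest) (ℤₚ.+-identityʳ y) above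
  AboveExceptLast-verticalRun⁺ y (suc c) rest -1≤end above =
    0≤y , AboveExceptLast-verticalRun⁺ (y ℤ.+ -1ℤ) c rest (subst (-1ℤ ℤ.≤_) (sym ([y-1]-c≡y-[1+c] y c)) -1≤end)
            (subst (λ h → AboveExceptLast h rest) (sym ([y-1]-c≡y-[1+c] y c)) above)
    where
    0≤y : 0ℤ ℤ.≤ y
    0≤y = ℤₚ.≤-trans (ℤ.+≤+ z≤n) (subst (+ c ℤ.≤_) ([i-j]+j≡i y (+ suc c)) (ℤₚ.+-monoˡ-≤ (+ suc c) -1≤end))

  AboveExceptLast-blocksPath⁻ : ∀ y bs → AboveExceptLast y (blocksPath bs) → NonnegWalk y (map weight bs)
  AboveExceptLast-blocksPath⁻ y []             _             = tt
  AboveExceptLast-blocksPath⁻ y ((b , c) ∷ bs) (0≤y , above) =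
    0≤y , AboveExceptLast-blocksPath⁻ (y ℤ.+ weight (b , c)) bs
            (subst (λ h → AboveExceptLast h (blocksPath bs)) (ℤₚ.+-assoc y (dy (slope b)) (ℤ.- + c))
              (AboveExceptLast-verticalRun⁻ (y ℤ.+ dy (slope b)) c (blocksPath bs) above))

  -- After its slanted step a block only descends, ending at height ≥ −1.
  AboveExceptLast-blocksPath⁺ : ∀ y bs → -1ℤ ℤ.≤ y ℤ.+ sumℤ (map weight bs) →
    NonnegWalk y (map weight bs) → AboveExceptLast y (blocksPath bs)
  AboveExceptLast-blocksPath⁺ y []             _      _            = tt
  AboveExceptLast-blocksPath⁺ y ((b , c) ∷ bs) -1≤end (0≤y , walk) =
    0≤y , AboveExceptLast-verticalRun⁺ (y ℤ.+ dy (slope b)) c (blocksPath bs)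
            (subst (-1ℤ ℤ.≤_) (sym assoc) (NonnegWalk⇒-1≤start y′ (map weight bs) walk -1≤end′))
            (subst (λ h → AboveExceptLast h (blocksPath bs)) (sym assoc)
              (AboveExceptLast-blocksPath⁺ y′ bs -1≤end′ walk))
    where
    y′ = y ℤ.+ weight (b , c)
    assoc : (y ℤ.+ dy (slope b)) ℤ.- + c ≡ y′
    assoc = ℤₚ.+-assoc y (dy (slope b)) (ℤ.- + c)
    -1≤end′ : -1ℤ ℤ.≤ y′ ℤ.+ sumℤ (map weight bs)
    -1≤end′ = subst (-1ℤ ℤ.≤_) (sym (ℤₚ.+-assoc y (weight (b , c)) _)) -1≤end

  AboveExceptLast-encode⇒c₀≡0 : ∀ c₀ b bs → AboveExceptLast 0ℤ (encode (c₀ , b ∷ bs)) → c₀ ≡ 0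
  AboveExceptLast-encode⇒c₀≡0 zero          _ _ _            = refl
  AboveExceptLast-encode⇒c₀≡0 (suc zero)    _ _ (_ , () , _)
  AboveExceptLast-encode⇒c₀≡0 (suc (suc _)) _ _ (_ , () , _)

  EndsAt : ℕ → ℕ → ℕ × List Block → Set
  EndsAt m n (c₀ , bs) = length bs ≡ n × ℤ.- + c₀ ℤ.+ sumℤ (map weight bs) ≡ ℤ.- + m

  image-encode⇔InF : ∀ m n p → Image encode (EndsAt m n) p ⇔ InF N K m n p
  image-encode⇔InF m n p = mk⇔ fromImage toImage
    where
    fromImage : Image encode (EndsAt m n) p → InF N K m n p
    fromImage ((c₀ , bs) , (∣bs∣≡n , height≡) , refl) =
      All-encode c₀ bs , trans (endpoint-encode c₀ bs) (cong₂ _,_ (cong +_ ∣bs∣≡n) height≡)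
    toImage : InF N K m n p → Image encode (EndsAt m n) p
    toImage (steps , end) =
      decode p , (ℤₚ.+-injective (cong proj₁ end′) , cong proj₂ end′) , encode-decode p steps
      where
      end′ = trans (sym (endpoint-encode (proj₁ (decode p)) (proj₂ (decode p))))
               (trans (cong endpoint (encode-decode p steps)) end)

  image-encode⇔InP : ∀ n → 0 < n → ∀ p →
    Image (λ bs → encode (0 , bs)) (NonnegBridge weight n) p ⇔ InP N K 1 n p
  image-encode⇔InP n 0<n p = mk⇔ fromImage toImage
    where
    fromImage : Image (λ bs → encode (0 , bs)) (NonnegBridge weight n) p → InP N K 1 n p
    fromImage (bs , ((∣bs∣≡n , sum≡-1) , walk) , refl) =
      to (image-encode⇔InF 1 n p) ((0 , bs) , (∣bs∣≡n , trans (ℤₚ.+-identityˡ _) sum≡-1) , refl) ,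
      AboveExceptLast-blocksPath⁺ 0ℤ bs (ℤₚ.≤-reflexive (sym (trans (ℤₚ.+-identityˡ _) sum≡-1))) walk
    toImage : InP N K 1 n p → Image (λ bs → encode (0 , bs)) (NonnegBridge weight n) p
    toImage (inF , above) with from (image-encode⇔InF 1 n p) inF
    ... | (_ , []) , (∣bs∣≡n , _) , _ = ⊥-elim (ℕₚ.<-irrefl ∣bs∣≡n 0<n)
    ... | (c₀ , b ∷ bs) , (∣bs∣≡n , height≡) , refl with AboveExceptLast-encode⇒c₀≡0 c₀ b bs above
    ... | refl = b ∷ bs , ((∣bs∣≡n , trans (sym (ℤₚ.+-identityˡ _)) height≡) ,
                           AboveExceptLast-blocksPath⁻ 0ℤ (b ∷ bs) above) , refl

  -- Counting

  Balanced : ℕ → List Bool × List ℕ → Set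
  Balanced m (w , cs) = falses w * N + m ≡ trues w * K + sum cs

  Admissible : ℕ → ℕ → ℕ → List Bool × List ℕ → Set
  Admissible n j m (w , cs) = length w ≡ n × length cs ≡ suc j × Balanced m (w , cs)

  private
    rise-identity : ∀ N f k m → (f * N + m) + k * N ≡ N * (f + k) + m
    rise-identity = ℕ-Solver.solve-∀
    fall-identity : ∀ N K k s → (k * K + s) + k * N ≡ s + k * (N + K)
    fall-identity = ℕ-Solver.solve-∀

  Balanced⇔ : ∀ {n} m w cs → length w ≡ n → Balanced m (w , cs) ⇔ (sum cs + trues w * (N + K) ≡ N * n + m)
  Balanced⇔ m w cs refl = mk⇔
    (λ bal → trans (sym (fall-identity N K k s)) (trans (cong (_+ k * N) (sym bal)) rise))
    (λ total → ℕₚ.+-cancelʳ-≡ (k * N) _ _ (trans rise (trans (sym total) (sym (fall-identity N K k s)))))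
    where
    k = trues w
    s = sum cs
    rise : (falses w * N + m) + k * N ≡ N * length w + m
    rise = trans (rise-identity N (falses w) k m) (cong (λ l → N * l + m) (falses+trues≡length w))

  ≤/⇔*≤ : ∀ k a → (k ≤ a / (N + K)) ⇔ (k * (N + K) ≤ a)
  ≤/⇔*≤ k a = mk⇔ (λ k≤ → ℕₚ.≤-trans (ℕₚ.*-monoˡ-≤ (N + K) k≤) (m/n*n≤m a (N + K)))
                  (λ k*≤ → subst (_≤ a / (N + K)) (m*n/n≡m k (N + K)) (/-monoˡ-≤ (N + K) k*≤))

  admissibleCount : ℕ → ℕ → ℕ → ℕ → ℕ
  admissibleCount n j m k = (n C k) * ((N * n + m ∸ k * (N + K) + j) C j)

  -- Classified by the number k of down steps, the vertical runs make up N n + m − k (N + K).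
  HasCard-Admissible : ∀ n j m →
    HasCard (Admissible n j m) (sumTo ((N * n + m) / (N + K)) (admissibleCount n j m))
  HasCard-Admissible n j m =
    HasCard-sumTo (trues ∘ proj₁) (admissibleCount n j m) ((N * n + m) / (N + K)) fibre bounded
    where
    fibre : ∀ k → k ≤ (N * n + m) / (N + K) →
      HasCard (λ (w , cs) → Admissible n j m (w , cs) × trues w ≡ k) (admissibleCount n j m k)
    fibre k k≤u = HasCard-cong (λ (w , cs) → mk⇔
        (λ { ((∣w∣≡n , refl) , (∣cs∣≡1+j , sum≡)) →
             (∣w∣≡n , ∣cs∣≡1+j , from (Balanced⇔ m w cs ∣w∣≡n) (from (+≡⇔≡∸ kd≤) sum≡)) , refl })
        (λ { ((∣w∣≡n , ∣cs∣≡1+j , bal) , refl) →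
             (∣w∣≡n , refl) , (∣cs∣≡1+j , to (+≡⇔≡∸ kd≤) (to (Balanced⇔ m w cs ∣w∣≡n) bal)) }))
      (HasCard-× (HasCard-Word n k) (HasCard-Composition j (N * n + m ∸ k * (N + K))))
      where
      kd≤ = to (≤/⇔*≤ k (N * n + m)) k≤u
    bounded : ∀ (x : List Bool × List ℕ) → Admissible n j m x → trues (proj₁ x) ≤ (N * n + m) / (N + K)
    bounded (w , cs) (∣w∣≡n , _ , bal) = from (≤/⇔*≤ (trues w) (N * n + m))
      (subst (trues w * (N + K) ≤_) (to (Balanced⇔ m w cs ∣w∣≡n) bal) (ℕₚ.m≤n+m _ (sum cs)))

  height⇔Balanced : ∀ m c₀ bs → let (w , cs) = unzip bs in
    (ℤ.- + c₀ ℤ.+ sumℤ (map weight bs) ≡ ℤ.- + m) ⇔ Balanced m (w , c₀ ∷ cs)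
  height⇔Balanced m c₀ bs =
    ⇔.trans (offset⇔ _ _ _ c₀ m (sumℤ-weights bs)) (mk⇔ (λ e → trans e reorder) (λ e → trans e (sym reorder)))
    where
    t = trues (proj₁ (unzip bs)) * K
    s = sum (proj₂ (unzip bs))
    reorder : c₀ + (t + s) ≡ t + (c₀ + s)
    reorder = trans (sym (ℕₚ.+-assoc c₀ t s)) (trans (cong (_+ s) (ℕₚ.+-comm c₀ t)) (ℕₚ.+-assoc t c₀ s))

  fromWordComposition : List Bool × List ℕ → ℕ × List Block
  fromWordComposition (w , [])      = 0 , []
  fromWordComposition (w , c₀ ∷ cs) = c₀ , zip w cs

  fromWordComposition-injective : ∀ {n m x y} → Admissible n n m x → Admissible n n m y →
    fromWordComposition x ≡ fromWordComposition y → x ≡ y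
  fromWordComposition-injective {x = w , c₀ ∷ cs} {w′ , c₀′ ∷ cs′} (∣w∣≡n , ∣cs∣≡ , _) (∣w′∣≡n , ∣cs′∣≡ , _) eq =
    cong₂ (λ (v , ds) d → v , d ∷ ds)
      (zip-injective (trans ∣w∣≡n (sym (ℕₚ.suc-injective ∣cs∣≡))) (trans ∣w′∣≡n (sym (ℕₚ.suc-injective ∣cs′∣≡)))
        (cong proj₂ eq))
      (cong proj₁ eq)

  image-fromWordComposition⇔EndsAt : ∀ m n x → Image fromWordComposition (Admissible n n m) x ⇔ EndsAt m n x
  image-fromWordComposition⇔EndsAt m n (c₀ , bs) = mk⇔
    (λ { ((w , c₀ ∷ cs) , (∣w∣≡n , ∣cs∣≡ , bal) , refl) →
         let ∣cs∣≡n = ℕₚ.suc-injective ∣cs∣≡ in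
         length-zip w cs ∣w∣≡n ∣cs∣≡n ,
         from (height⇔Balanced m c₀ (zip w cs))
           (subst (λ (v , ds) → Balanced m (v , c₀ ∷ ds)) (sym (unzip-zip w cs (trans ∣w∣≡n (sym ∣cs∣≡n)))) bal) })
    (λ (∣bs∣≡n , height≡) →
       (proj₁ (unzip bs) , c₀ ∷ proj₂ (unzip bs)) ,
       (trans (length-unzipWith₁ id bs) ∣bs∣≡n , cong suc (trans (length-unzipWith₂ id bs) ∣bs∣≡n) ,
        to (height⇔Balanced m c₀ bs) height≡) ,
       cong (c₀ ,_) (zip-unzip bs))

  image-zip⇔Bridge : ∀ j bs → Image (λ (w , cs) → zip w cs) (Admissible (suc j) j 1) bs ⇔ Bridge weight (suc j) bs
  image-zip⇔Bridge j bs = mk⇔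
    (λ { ((w , cs) , (∣w∣≡n , ∣cs∣≡n , bal) , refl) →
         length-zip w cs ∣w∣≡n ∣cs∣≡n ,
         trans (sym (ℤₚ.+-identityˡ _))
           (from (height⇔Balanced 1 0 (zip w cs))
             (subst (Balanced 1) (sym (unzip-zip w cs (trans ∣w∣≡n (sym ∣cs∣≡n)))) bal)) })
    (λ (∣bs∣≡n , sum≡-1) →
       unzip bs ,
       (trans (length-unzipWith₁ id bs) ∣bs∣≡n , trans (length-unzipWith₂ id bs) ∣bs∣≡n ,
        to (height⇔Balanced 1 0 bs) (trans (ℤₚ.+-identityˡ _) sum≡-1)) ,
       zip-unzip bs)

  HasCard-Bridge-blocks : ∀ j →
    HasCard (Bridge weight (suc j)) (sumTo ((N * suc j + 1) / (N + K)) (admissibleCount (suc j) j 1))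
  HasCard-Bridge-blocks j = HasCard-cong (image-zip⇔Bridge j)
    (HasCard-image (λ (w , cs) → zip w cs)
      (λ (∣w∣≡n , ∣cs∣≡n , _) (∣w′∣≡n , ∣cs′∣≡n , _) →
         zip-injective (trans ∣w∣≡n (sym ∣cs∣≡n)) (trans ∣w′∣≡n (sym ∣cs′∣≡n)))
      (HasCard-Admissible (suc j) j 1))

  admissibleCount-InF : ∀ m n k → k ≤ (N * n + m) / (N + K) →
    admissibleCount n n m k ≡ (n C k) * ((n * (N + 1) + m ∸ k * (N + K)) C n)
  admissibleCount-InF m n k k≤u = cong (λ t → (n C k) * (t C n))
    (trans (sym (ℕₚ.+-∸-comm n (to (≤/⇔*≤ k _) k≤u))) (cong (_∸ k * (N + K)) (identity N n m)))
    where
    identity : ∀ N n m → N * n + m + n ≡ n * (N + 1) + m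
    identity = ℕ-Solver.solve-∀

  admissibleCount-InP : ∀ j k → k ≤ (N * suc j + 1) / (N + K) →
    admissibleCount (suc j) j 1 k ≡ (suc j C k) * ((suc j * (N + 1) ∸ k * (N + K)) C j)
  admissibleCount-InP j k k≤u = cong (λ t → (suc j C k) * (t C j))
    (trans (sym (ℕₚ.+-∸-comm j (to (≤/⇔*≤ k _) k≤u))) (cong (_∸ k * (N + K)) (identity N j)))
    where
    identity : ∀ N j → N * suc j + 1 + j ≡ suc j * (N + 1)
    identity = ℕ-Solver.solve-∀

  HasCard-InF : ∀ m n →
    HasCard (InF N K m n) (sumTo ((N * n + m) / (N + K)) (λ k → (n C k) * ((n * (N + 1) + m ∸ k * (N + K)) C n)))
  HasCard-InF m n =
    subst (HasCard (InF N K m n)) (sumTo-cong _ (admissibleCount-InF m n))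
      (HasCard-cong (image-encode⇔InF m n)
        (HasCard-image encode (λ _ _ → encode-injective)
          (HasCard-cong (image-fromWordComposition⇔EndsAt m n)
            (HasCard-image fromWordComposition fromWordComposition-injective (HasCard-Admissible n n m)))))

  HasCard-InP : ∀ n → 1 ≤ n → Σ ℕ λ c → HasCard (InP N K 1 n) c ×
    n * c ≡ sumTo ((N * n + 1) / (N + K)) (λ k → (n C k) * ((n * (N + 1) ∸ k * (N + K)) C (n ∸ 1)))
  HasCard-InP (suc j) 0<n =
    let (c , nonneg) = HasCard-filter (λ bs → NonnegWalk? 0ℤ (map weight bs)) (HasCard-Bridge-blocks j) in
    c ,
    HasCard-cong (image-encode⇔InP (suc j) 0<n)
      (HasCard-image (λ bs → encode (0 , bs)) (λ _ _ → cong proj₂ ∘ encode-injective) nonneg) ,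
    trans (ℕₚ.*-comm (suc j) c)
      (trans (HasCard-unique (HasCard-Bridge weight 0<n nonneg) (HasCard-Bridge-blocks j))
        (sumTo-cong _ (admissibleCount-InP j)))

mainTheorem20 : (N K : ℕ) → 1 ≤ N → 1 ≤ K →
    ((m n : ℕ) → 1 ≤ n →
      HasCard (InF N K m n)
        (sumTo (floorDiv (N * n + m) (N + K))
          (λ k → (n C k) * ((n * (N + 1) + m ∸ k * (N + K)) C n))))
    ×
    ((n : ℕ) → 1 ≤ n →
      Σ ℕ λ c → HasCard (InP N K 1 n) c ×
        n * c ≡ sumTo (floorDiv (N * n + 1) (N + K))
          (λ k → (n C k) * ((n * (N + 1) ∸ k * (N + K)) C (n ∸ 1))))
mainTheorem20 (suc N′) (suc K′) _ _ = (λ m n _ → HasCard-InF m n) , HasCard-InP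
  where open Enumeration N′ K′
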